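{- Let $T$ be a quadrangular tournament with a vertex $x$ of in-degree $1$, and let $y$ be the vertex with $y\rightarrow x$. Then $I(y)=V(T)\setminus\{x,y\}$.
   Context: A tournament $T$ is a loopless digraph in which for each pair of distinct vertices exactly one of $(u,v)$, $(v,u)$ is an arc; $u\rightarrow v$ means $(u,v)$ is an arc. $O(v)=\{u:v\rightarrow u\}$, $I(v)=\{u:u\rightarrow v\}$. A digraph is quadrangular if for all distinct vertices $u,v$, $|O(u)\cap O(v)|\neq 1$ and $|I(u)\cap I(v)|\neq 1$. -}

module Defs where

open import Data.Nat using (ℕ)
open import Data.Bool using (Bool; true; false; _∧_; T; not)
open import Data.Fin using (Fin)
open import Data.List using (List; filter; length)
open import Data.List using () renaming (allFin to allFinL)
open import Data.Bool.Properties using (T?)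
open import Data.Product using (_×_)
open import Relation.Binary.PropositionalEquality using (_≡_; _≢_)

-- A digraph on vertex set Fin n, given by its Boolean adjacency:
-- arc u v = true  iff  (u , v) is an arc, i.e. u → v.
Digraph : ℕ → Set
Digraph n = Fin n → Fin n → Bool

_⟶[_]_ : ∀ {n} → Fin n → Digraph n → Fin n → Set
u ⟶[ D ] v = T (D u v)

record IsTournament {n : ℕ} (D : Digraph n) : Set where
  field
    loopless : ∀ u → D u u ≡ false
    complete : ∀ u v → u ≢ v → D u v ≡ not (D v u)

count : ∀ {n} → (Fin n → Bool) → ℕ
count {n} p = length (filter (λ w → T? (p w)) (allFinL n))

commonOut : ∀ {n} → Digraph n → Fin n → Fin n → ℕ
commonOut D u v = count (λ w → D u w ∧ D v w)

commonIn : ∀ {n} → Digraph n → Fin n → Fin n → ℕ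
commonIn D u v = count (λ w → D w u ∧ D w v)

inDegree : ∀ {n} → Digraph n → Fin n → ℕ
inDegree D v = count (λ w → D w v)

IsQuadrangular : ∀ {n} → Digraph n → Set
IsQuadrangular {n} D = ∀ (u v : Fin n) → u ≢ v → (commonOut D u v ≢ 1) × (commonIn D u v ≢ 1)

-- If y is the only in-neighbour of x and y → v for some v ≠ x, then
-- I(x) ∩ I(v) = {y}, which quadrangularity forbids.  So y beats only x, and in a
-- tournament every other vertex v ≠ y therefore beats y.
module Submission where

open import Defs
open import Data.Nat using (ℕ; _≤_; _<_)
open import Data.Nat.Properties using (≤-antisym; ≤-trans; ≤-reflexive)
open import Data.Fin using (Fin)
open import Data.Bool using (Bool; true; false; T; _∧_)
open import Data.Bool.Properties using (T?; T-∧; T-not-≡)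
open import Data.Unit using (tt)
open import Data.Empty using (⊥-elim)
open import Data.Sum using (_⊎_; inj₁; inj₂; [_,_]′)
open import Data.Product using (_×_; _,_; proj₁; proj₂)
open import Data.List using (allFin)
open import Data.List.Membership.Propositional.Properties using (∈-allFin; ∈-filter⁺; ∈-length)
open import Data.List.Relation.Binary.Sublist.Propositional using (⊆-refl)
open import Data.List.Relation.Binary.Sublist.Propositional.Properties using (filter⁺; length-mono-≤)
open import Function using (_∘_; id)
open import Function.Bundles using (_⇔_; mk⇔; Equivalence)
open import Relation.Nullary using (¬_)
open import Relation.Binary.PropositionalEquality using (_≡_; _≢_; refl; sym; subst)

open Equivalence using (to; from)

private
  variable
    n : ℕ
    D : Digraph n
    u v x y : Fin n

count-mono : (p q : Fin n → Bool) → (∀ w → T (p w) → T (q w)) → count p ≤ count q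
count-mono {n} p q p⇒q =
  length-mono-≤ (filter⁺ (T? ∘ p) (T? ∘ q) (λ { refl → p⇒q _ }) (⊆-refl {x = allFin n}))

count-pos : (p : Fin n → Bool) → T (p u) → 0 < count p
count-pos {u = u} p pu = ∈-length (∈-filter⁺ (T? ∘ p) (∈-allFin u) pu)

inDegree≡1⇒commonIn≡1 : (D : Digraph n) → inDegree D x ≡ 1 →
                         y ⟶[ D ] x → y ⟶[ D ] v → commonIn D x v ≡ 1
inDegree≡1⇒commonIn≡1 {x = x} {v = v} D deg yx yv = ≤-antisym
  (≤-trans (count-mono _ (λ w → D w x) (λ w → proj₁ ∘ T-∧ .to)) (≤-reflexive deg))
  (count-pos (λ w → D w x ∧ D w v) (T-∧ .from (yx , yv)))

sole-in-neighbour-¬⟶ : (D : Digraph n) → IsQuadrangular D → inDegree D x ≡ 1 →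
                       y ⟶[ D ] x → v ≢ x → ¬ (y ⟶[ D ] v)
sole-in-neighbour-¬⟶ D quad deg yx v≢x yv =
  proj₂ (quad _ _ (v≢x ∘ sym)) (inDegree≡1⇒commonIn≡1 D deg yx yv)

module _ (tournament : IsTournament D) where
  open IsTournament tournament

  ⟶-irrefl : u ⟶[ D ] v → u ≢ v
  ⟶-irrefl {u} uv refl = subst T (loopless u) uv

  ⟶-asym : u ⟶[ D ] v → ¬ (v ⟶[ D ] u)
  ⟶-asym {u} {v} uv = subst T (T-not-≡ .to (subst T (complete u v (⟶-irrefl uv)) uv))

  ⟶-total : u ≢ v → u ⟶[ D ] v ⊎ v ⟶[ D ] u
  ⟶-total {u} {v} u≢v with D v u in vu
  ... | true  = inj₂ tt
  ... | false = inj₁ (subst T (sym (complete u v u≢v)) (T-not-≡ .from vu))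

lemma6 : ∀ {n : ℕ} (D : Digraph n) → IsTournament D → IsQuadrangular D →
         ∀ (x y : Fin n) → inDegree D x ≡ 1 → y ⟶[ D ] x →
         ∀ (v : Fin n) → (v ⟶[ D ] y) ⇔ (v ≢ x × v ≢ y)
lemma6 D tournament quad x y deg yx v = mk⇔ beats-y⇒≢ ≢⇒beats-y
  where
  beats-y⇒≢ : v ⟶[ D ] y → v ≢ x × v ≢ y
  beats-y⇒≢ vy = (λ { refl → ⟶-asym tournament yx vy }) , ⟶-irrefl tournament vy

  ≢⇒beats-y : v ≢ x × v ≢ y → v ⟶[ D ] y
  ≢⇒beats-y (v≢x , v≢y) =
    [ id , ⊥-elim ∘ sole-in-neighbour-¬⟶ D quad deg yx v≢x ]′ (⟶-total tournament v≢y)
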